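{- For every integer $n\ge 1$, $s(n)<s(n+1)$.
   Context: A (normal) logic program is a finite set of clauses $a\leftarrow b_1,\ldots,b_m,\mathbf{not}(c_1),\ldots,\mathbf{not}(c_k)$ with atoms $a,b_i,c_j$. For a set of atoms $M$, the reduct $P^M$ is obtained by deleting every clause whose body contains $\mathbf{not}(c)$ with $c\in M$ and deleting all negative literals from the remaining clauses; $M$ is a stable model of $P$ if $M$ is the least model of $P^M$. $s(n)$ is the maximum number of stable models of a logic program with at most $n$ clauses. -}

module Defs where

open import Level using (0ℓ)
open import Data.Nat using (ℕ; _≤_; _<_; _≟_)
open import Data.List using (List; map; filter; length)
open import Data.List.Relation.Unary.All using (All; all?)
open import Data.List.Relation.Unary.AllPairs using (AllPairs)
open import Data.List.Relation.Unary.Any using (Any)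
open import Data.List.Membership.Propositional using (_∈_; _∉_)
open import Data.List.Membership.DecPropositional _≟_ using (_∈?_)
open import Data.Product using (Σ; _×_)
open import Relation.Nullary using (¬_; ¬?)
open import Relation.Binary.PropositionalEquality using (_≡_)
open import Relation.Unary using (Pred)

Atom : Set
Atom = ℕ

record Clause : Set where
  constructor _←_,not_
  field
    head : Atom
    pos  : List Atom
    neg  : List Atom
open Clause public

record PosClause : Set where
  constructor _⇐_
  field
    phead : Atom
    pbody : List Atom
open PosClause public

-- A (normal) logic program: a finite list of clauses;
-- its number of clauses is its length.
Program : Set
Program = List Clause

PosProgram : Set
PosProgram = List PosClause

-- Sets of atoms considered as candidate stable models: finite sets,
-- represented by lists (read up to membership).
AtomSet : Set
AtomSet = List Atom

toPos : Clause → PosClause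
toPos cl = head cl ⇐ pos cl

reduct : Program → AtomSet → PosProgram
reduct P M = map toPos (filter (λ cl → all? (λ c → ¬? (c ∈? M)) (neg cl)) P)

IsModel : PosProgram → Pred Atom 0ℓ → Set
IsModel Q X = All (λ cl → All X (pbody cl) → X (phead cl)) Q

IsLeastModel : PosProgram → AtomSet → Set₁
IsLeastModel Q M =
  IsModel Q (λ a → a ∈ M) × ((X : Pred Atom 0ℓ) → IsModel Q X → ∀ a → a ∈ M → X a)

IsStableModel : Program → AtomSet → Set₁
IsStableModel P M = IsLeastModel (reduct P M) M

SameSet : AtomSet → AtomSet → Set
SameSet M N = ∀ a → (a ∈ M → a ∈ N) × (a ∈ N → a ∈ M)

HasAtLeastStable : Program → ℕ → Set₁
HasAtLeastStable P k =
  Σ (List AtomSet) λ Ms → length Ms ≡ k × All (IsStableModel P) Ms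
    × AllPairs (λ M N → ¬ SameSet M N) Ms

HasAtMostStable : Program → ℕ → Set₁
HasAtMostStable P k =
  (Ms : List AtomSet) → All (IsStableModel P) Ms
    → AllPairs (λ M N → ¬ SameSet M N) Ms → length Ms ≤ k

-- s(n) = k : k is the maximum number of stable models of a program
-- with at most n clauses.
IsS : ℕ → ℕ → Set₁
IsS n k =
  Σ Program (λ P → length P ≤ n × HasAtLeastStable P k)
  × ((P : Program) → length P ≤ n → HasAtMostStable P k)

module Submission where

-- A stable model of P consists of heads of P, and stability is decidable (least models of
-- definite programs are computable), so the stable models of P can be counted among the subsets
-- of its heads. Sending the heads of a program with at most n clauses injectively into
-- {0, …, n-1}, and every other atom to n, carries its stable models injectively to stable models
-- of a program built from finitely many canonical clauses; so s(n) is a maximum over a finite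
-- family. For strictness, take P with s(n) stable models. If there are at least two, none is
-- empty (an empty stable model is the only one), and for an atom z outside the heads h₁, …, hₖ
-- of P, adding z ← not h₁, …, not hₖ and guarding every clause of P by not z keeps them all and
-- adds {z}. Otherwise {0 ← not 1, 1 ← not 0} already has two stable models and n + 1 ≥ 2 clauses.

open import Level using (0ℓ)
open import Defs
open import Data.Bool using (true; false)
open import Data.Nat using (ℕ; zero; suc; _≤_; _<_; _≟_; z≤n; s≤s)
import Data.Nat.Properties as ℕ
open import Data.Fin using (Fin; zero; suc; toℕ)
import Data.Fin.Properties as Fin
open import Data.List
  using (List; []; _∷_; _++_; map; filter; length; upTo; lookup; deduplicate; cartesianProduct; cartesianProductWith)
import Data.List.Properties as List
open import Data.List.Extrema.Nat using (argmax; argmax-all; f[xs]≤f[argmax]; max; xs≤max)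
open import Data.List.Membership.DecPropositional _≟_ using (_∈?_)
open import Data.List.Membership.Propositional using (_∈_; _∉_; lose)
open import Data.List.Membership.Propositional.Properties
import Data.List.Membership.Setoid as SetoidMembership
import Data.List.Membership.Setoid.Properties as SetoidMembershipₚ
open import Data.List.Relation.Binary.Subset.Propositional using (_⊆_)
open import Data.List.Relation.Binary.Subset.DecPropositional _≟_ using (_⊆?_)
open import Data.List.Relation.Unary.All as All using (All; []; _∷_; all?)
import Data.List.Relation.Unary.All.Properties as All
open import Data.List.Relation.Unary.AllPairs using (AllPairs; []; _∷_)
open import Data.List.Relation.Unary.Any as Any using (here; there)
import Data.List.Relation.Unary.Unique.DecSetoid.Properties as DecSetoidUniqueₚ
import Data.List.Relation.Unary.Unique.Setoid as SetoidUnique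
import Data.List.Relation.Unary.Unique.Setoid.Properties as SetoidUniqueₚ
open import Data.Product using (Σ; ∃-syntax; _×_; _,_; proj₁; proj₂)
open import Data.Sum using (_⊎_; inj₁; inj₂)
open import Function using (_∘_; id; case_of_)
open import Relation.Binary using (Setoid; DecSetoid) renaming (Decidable to Decidable₂)
open import Relation.Binary.PropositionalEquality
  using (_≡_; refl; sym; cong; subst; module ≡-Reasoning) renaming (setoid to ≡-setoid)
open import Relation.Nullary using (does; yes; no; ¬?; contradiction)
open import Relation.Nullary.Decidable using (map′; _×-dec_)
open import Relation.Unary using (Pred; Decidable)

subsets : ∀ {a} {A : Set a} → List A → List (List A)
subsets []       = [] ∷ []
subsets (x ∷ xs) = map (x ∷_) (subsets xs) ++ subsets xs

filter∈subsets : ∀ {a p} {A : Set a} {P : Pred A p} (P? : Decidable P) xs → filter P? xs ∈ subsets xs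
filter∈subsets P? []       = here refl
filter∈subsets P? (x ∷ xs) with does (P? x)
... | true  = ∈-++⁺ˡ (∈-map⁺ (x ∷_) (filter∈subsets P? xs))
... | false = ∈-++⁺ʳ (map (x ∷_) (subsets xs)) (filter∈subsets P? xs)

listsUpTo : ∀ {a} {A : Set a} → ℕ → List A → List (List A)
listsUpTo zero    C = [] ∷ []
listsUpTo (suc k) C = [] ∷ cartesianProductWith _∷_ C (listsUpTo k C)

∈-listsUpTo⁺ : ∀ {a} {A : Set a} {k} {C xs : List A} →
  length xs ≤ k → All (_∈ C) xs → xs ∈ listsUpTo k C
∈-listsUpTo⁺ {k = zero}  {xs = []}    _         _            = here refl
∈-listsUpTo⁺ {k = suc k} {xs = []}    _         _            = here refl
∈-listsUpTo⁺ {k = suc k} {xs = _ ∷ _} (s≤s len) (x∈C ∷ xs⊆C) =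
  there (∈-cartesianProductWith⁺ _∷_ x∈C (∈-listsUpTo⁺ len xs⊆C))

listsUpTo-length : ∀ {a} {A : Set a} k (C : List A) → All (λ xs → length xs ≤ k) (listsUpTo k C)
listsUpTo-length zero    C = z≤n ∷ []
listsUpTo-length (suc k) C = z≤n ∷ All.tabulate λ xs∈ →
  case ∈-cartesianProductWith⁻ _∷_ C (listsUpTo k C) xs∈ of λ where
    (_ , _ , _ , ys∈ , refl) → s≤s (All.lookup (listsUpTo-length k C) ys∈)

filter-map : ∀ {a b p} {A : Set a} {B : Set b} {P : Pred B p} (P? : Decidable P) (f : A → B) xs →
  filter P? (map f xs) ≡ map f (filter (P? ∘ f) xs)
filter-map P? f []       = refl
filter-map P? f (x ∷ xs) with does (P? (f x))
... | true  = cong (f x ∷_) (filter-map P? f xs)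
... | false = filter-map P? f xs

AllPairs-map⁺-on : ∀ {a b p r s} {A : Set a} {B : Set b} {P : Pred A p}
  {R : A → A → Set r} {S : B → B → Set s} {f : A → B} {xs} →
  (∀ {x y} → P x → P y → R x y → S (f x) (f y)) → All P xs → AllPairs R xs → AllPairs S (map f xs)
AllPairs-map⁺-on g []         []         = []
AllPairs-map⁺-on g (px ∷ pxs) (rx ∷ rxs) =
  All.map⁺ (All.zipWith (λ (py , r) → g px py r) (pxs , rx)) ∷ AllPairs-map⁺-on g pxs rxs

module _ {a ℓ} (S : Setoid a ℓ) where
  open Setoid S using (_≈_) renaming (sym to ≈-sym)
  open SetoidMembership S using () renaming (_∈_ to _∈ₛ_)
  open SetoidUnique S using (Unique)

  Unique-lookup-injective : ∀ {xs} → Unique xs → ∀ {i j} → lookup xs i ≈ lookup xs j → i ≡ j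
  Unique-lookup-injective (_ ∷ _)        {zero}  {zero}  _  = refl
  Unique-lookup-injective (x≉xs ∷ _)     {zero}  {suc j} eq = contradiction eq (All.lookup x≉xs (∈-lookup j))
  Unique-lookup-injective (x≉xs ∷ _)     {suc i} {zero}  eq =
    contradiction (≈-sym eq) (All.lookup x≉xs (∈-lookup i))
  Unique-lookup-injective (_ ∷ distinct) {suc i} {suc j} eq = cong suc (Unique-lookup-injective distinct eq)

  Unique⇒length≤ : ∀ {xs ys} → Unique xs → All (_∈ₛ ys) xs → length xs ≤ length ys
  Unique⇒length≤ {xs} {ys} distinct xs⊆ys = Fin.injective⇒≤ {f = slot} injective
    where
    slot : Fin (length xs) → Fin (length ys)
    slot i = Any.index (All.lookup xs⊆ys (∈-lookup i))
    injective : ∀ {i j} → slot i ≡ slot j → i ≡ j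
    injective eq = Unique-lookup-injective distinct (SetoidMembershipₚ.index-injective S _ _ eq)

SameSet-refl : ∀ {M} → SameSet M M
SameSet-refl a = id , id

SameSet-sym : ∀ {M N} → SameSet M N → SameSet N M
SameSet-sym M≋N a = proj₂ (M≋N a) , proj₁ (M≋N a)

SameSet-trans : ∀ {L M N} → SameSet L M → SameSet M N → SameSet L N
SameSet-trans L≋M M≋N a = proj₁ (M≋N a) ∘ proj₁ (L≋M a) , proj₂ (L≋M a) ∘ proj₂ (M≋N a)

SameSet? : Decidable₂ SameSet
SameSet? M N = map′ to from (M ⊆? N ×-dec N ⊆? M)
  where
  to : M ⊆ N × N ⊆ M → SameSet M N
  to (M⊆N , N⊆M) a = M⊆N , N⊆M
  from : SameSet M N → M ⊆ N × N ⊆ M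
  from M≋N = proj₁ (M≋N _) , proj₂ (M≋N _)

≋-decSetoid : DecSetoid 0ℓ 0ℓ
≋-decSetoid = record
  { Carrier          = AtomSet
  ; _≈_              = SameSet
  ; isDecEquivalence = record
    { isEquivalence = record { refl = SameSet-refl ; sym = SameSet-sym ; trans = SameSet-trans }
    ; _≟_           = SameSet?
    }
  }

≋-setoid : Setoid 0ℓ 0ℓ
≋-setoid = DecSetoid.setoid ≋-decSetoid

open SetoidMembership ≋-setoid using () renaming (_∈_ to _∈≋_)
open SetoidUnique ≋-setoid using (Unique)

SameSet-filter-∈ : ∀ {M xs} → M ⊆ xs → SameSet M (filter (_∈? M) xs)
SameSet-filter-∈ {M} {xs} M⊆xs a =
  (λ a∈M → ∈-filter⁺ (_∈? M) (M⊆xs a∈M) a∈M) , proj₂ ∘ ∈-filter⁻ (_∈? M) {xs = xs}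

fresh : List Atom → Atom
fresh L = suc (max 0 L)

fresh-∉ : ∀ L → fresh L ∉ L
fresh-∉ L fresh∈L = ℕ.1+n≰n (All.lookup (xs≤max 0 L) fresh∈L)

-- Least models

Fires : AtomSet → Pred PosClause 0ℓ
Fires S c = All (_∈ S) (pbody c)

fires? : ∀ S → Decidable (Fires S)
fires? S c = all? (_∈? S) (pbody c)

module _ (Q : PosProgram) where

  private
    Sound : AtomSet → Set₁
    Sound S = (X : Pred Atom 0ℓ) → IsModel Q X → ∀ a → a ∈ S → X a

    Pending : PosProgram → AtomSet → Set
    Pending R S = All (λ c → c ∈ R ⊎ phead c ∈ S) Q

    search : ∀ k R S → length R ≤ k → R ⊆ Q → Pending R S → Sound S → Σ AtomSet (IsLeastModel Q)
    search k R S len R⊆Q pending sound with All.search (fires? S) R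
    ... | inj₁ idle = S , All.map closed pending , sound
      where
      closed : ∀ {c} → c ∈ R ⊎ phead c ∈ S → Fires S c → phead c ∈ S
      closed (inj₁ c∈R)   fires = contradiction fires (All.lookup idle c∈R)
      closed (inj₂ head∈) _     = head∈
    search zero    []      S _   _   _ _ | inj₂ ()
    search (suc k) R       S len R⊆Q pending sound | inj₂ active =
      search k R′ S′ len′ (R⊆Q ∘ proj₁ ∘ ∈-filter⁻ (¬? ∘ fires? S)) (All.map step pending) sound′
      where
      R′ = filter (¬? ∘ fires? S) R
      fired = filter (fires? S) R
      S′ = map phead fired ++ S
      shrinks : length R′ < length R
      shrinks = List.filter-notAll (¬? ∘ fires? S) R (Any.map (λ fires idle → idle fires) active)
      len′ : length R′ ≤ k
      len′ = ℕ.≤-pred (ℕ.<-≤-trans shrinks len)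
      step : ∀ {c} → c ∈ R ⊎ phead c ∈ S → c ∈ R′ ⊎ phead c ∈ S′
      step {c} (inj₁ c∈R) with fires? S c
      ... | yes fires = inj₂ (∈-++⁺ˡ (∈-map⁺ phead (∈-filter⁺ (fires? S) c∈R fires)))
      ... | no idle   = inj₁ (∈-filter⁺ (¬? ∘ fires? S) c∈R idle)
      step (inj₂ head∈) = inj₂ (∈-++⁺ʳ (map phead fired) head∈)
      sound′ : Sound S′
      sound′ X model a a∈S′ with ∈-++⁻ (map phead fired) a∈S′
      ... | inj₂ a∈S = sound X model a a∈S
      ... | inj₁ a∈heads with ∈-map⁻ phead a∈heads
      ...   | c , c∈fired , refl with ∈-filter⁻ (fires? S) {xs = R} c∈fired
      ...     | c∈R , fires = All.lookup model (R⊆Q c∈R) (All.map (sound X model _) fires)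

  leastModel : Σ AtomSet (IsLeastModel Q)
  leastModel = search (length Q) Q [] ℕ.≤-refl id (All.tabulate inj₁) (λ _ _ _ ())

leastModel-unique : ∀ {Q M N} → IsLeastModel Q M → IsLeastModel Q N → SameSet M N
leastModel-unique (M-model , M-least) (N-model , N-least) a =
  M-least (_∈ _) N-model a , N-least (_∈ _) M-model a

IsLeastModel-resp : ∀ {Q M N} → SameSet M N → IsLeastModel Q M → IsLeastModel Q N
IsLeastModel-resp M≋N (model , least) =
  All.map (λ closed → to ∘ closed ∘ All.map from) model , λ X X-model a → least X X-model a ∘ from
  where
  to   = λ {a} → proj₁ (M≋N a)
  from = λ {a} → proj₂ (M≋N a)

fact-leastModel : ∀ a → IsLeastModel ((a ⇐ []) ∷ []) (a ∷ [])
fact-leastModel a = (λ _ → here refl) ∷ [] , λ { X (fact ∷ []) _ (here refl) → fact [] }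

-- Stable models

Kept : AtomSet → Pred Clause 0ℓ
Kept M cl = All (_∉ M) (neg cl)

kept? : ∀ M → Decidable (Kept M)
kept? M cl = all? (λ c → ¬? (c ∈? M)) (neg cl)

All∉-antitone : ∀ {M N : AtomSet} {cs} → M ⊆ N → All (_∉ N) cs → All (_∉ M) cs
All∉-antitone M⊆N = All.map (λ c∉N → c∉N ∘ M⊆N)

∈-reduct⁺ : ∀ {P M cl} → cl ∈ P → Kept M cl → toPos cl ∈ reduct P M
∈-reduct⁺ {M = M} cl∈P kept = ∈-map⁺ toPos (∈-filter⁺ (kept? M) cl∈P kept)

∈-reduct⁻ : ∀ {P M c} → c ∈ reduct P M → ∃[ cl ] cl ∈ P × Kept M cl × c ≡ toPos cl
∈-reduct⁻ {P} {M} c∈ with ∈-map⁻ toPos c∈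
... | cl , cl∈ , refl with ∈-filter⁻ (kept? M) {xs = P} cl∈
...   | cl∈P , kept = cl , cl∈P , kept , refl

IsModel-reduct⁺ : ∀ {P M} {X : Pred Atom 0ℓ} →
  (∀ {cl} → cl ∈ P → Kept M cl → All X (pos cl) → X (head cl)) → IsModel (reduct P M) X
IsModel-reduct⁺ {P} closed = All.tabulate λ c∈ → case ∈-reduct⁻ {P} c∈ of λ where
  (cl , cl∈P , kept , refl) → closed cl∈P kept

IsModel-reduct⁻ : ∀ {P M cl} {X : Pred Atom 0ℓ} →
  IsModel (reduct P M) X → cl ∈ P → Kept M cl → All X (pos cl) → X (head cl)
IsModel-reduct⁻ model cl∈P kept = All.lookup model (∈-reduct⁺ cl∈P kept)

IsModel-reduct-antitone : ∀ {P M N} {X : Pred Atom 0ℓ} →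
  M ⊆ N → IsModel (reduct P M) X → IsModel (reduct P N) X
IsModel-reduct-antitone {P} {M} M⊆N model =
  IsModel-reduct⁺ {P} λ cl∈P kept → IsModel-reduct⁻ {P} {M} model cl∈P (All∉-antitone M⊆N kept)

reduct-resp : ∀ P {M N} → SameSet M N → reduct P M ≡ reduct P N
reduct-resp P {M} {N} M≋N = cong (map toPos) (List.filter-≐ (kept? M) (kept? N)
  (All∉-antitone (proj₂ (M≋N _)) , All∉-antitone (proj₁ (M≋N _))) P)

stable? : ∀ P → Decidable (IsStableModel P)
stable? P M with leastModel (reduct P M)
... | L , L-least = map′ (λ M≋L → IsLeastModel-resp (SameSet-sym M≋L) L-least)
                         (λ M-least → leastModel-unique M-least L-least) (SameSet? M L)

IsStableModel-resp : ∀ {P M N} → SameSet M N → IsStableModel P M → IsStableModel P N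
IsStableModel-resp {P} M≋N stable =
  subst (λ Q → IsLeastModel Q _) (reduct-resp P M≋N) (IsLeastModel-resp M≋N stable)

stable⊆heads : ∀ {P M} → IsStableModel P M → M ⊆ map head P
stable⊆heads {P} (_ , least) =
  least (_∈ map head P) (IsModel-reduct⁺ {P} λ cl∈P _ _ → ∈-map⁺ head cl∈P) _

-- P^N ⊆ P^∅, so the empty set, a model of P^∅, is also a model of P^N.
stable-[]-unique : ∀ {P N} → IsStableModel P [] → IsStableModel P N → SameSet [] N
stable-[]-unique {P} {N} ([]-model , _) (_ , N-least) a =
  (λ ()) , N-least (_∈ []) (IsModel-reduct-antitone {P} {[]} {N} (λ ()) []-model) a

distinct-stable-nonempty : ∀ {P M₁ M₂ Ms} →
  All (IsStableModel P) (M₁ ∷ M₂ ∷ Ms) → Unique (M₁ ∷ M₂ ∷ Ms) →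
  All (λ M → ∃[ a ] a ∈ M) (M₁ ∷ M₂ ∷ Ms)
distinct-stable-nonempty {P} {M₁} {M₂} {Ms} stable ((M₁≉M₂ ∷ _) ∷ _) = All.tabulate nonempty
  where
  nonempty : ∀ {M} → M ∈ M₁ ∷ M₂ ∷ Ms → ∃[ a ] a ∈ M
  nonempty {a ∷ _} _   = a , here refl
  nonempty {[]}    []∈ =
    contradiction (SameSet-trans (SameSet-sym ([]≋ M₁-stable)) ([]≋ M₂-stable)) M₁≉M₂
    where
    []≋ : ∀ {N} → IsStableModel P N → SameSet [] N
    []≋ = stable-[]-unique {P} (All.lookup stable []∈)
    M₁-stable = All.head stable
    M₂-stable = All.head (All.tail stable)

-- Counting stable models

candidates : Program → List AtomSet
candidates P = deduplicate SameSet? (subsets (map head P))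

stableModels : Program → List AtomSet
stableModels P = filter (stable? P) (candidates P)

stableModels-complete : ∀ {P M} → IsStableModel P M → M ∈≋ stableModels P
stableModels-complete {P} {M} stable =
  SetoidMembershipₚ.∈-filter⁺ ≋-setoid (stable? P) (IsStableModel-resp {P}) M∈candidates stable
  where
  M∈subsets : M ∈≋ subsets (map head P)
  M∈subsets = Any.map (λ { refl → SameSet-filter-∈ (stable⊆heads {P} stable) })
                      (filter∈subsets (_∈? M) (map head P))
  M∈candidates : M ∈≋ candidates P
  M∈candidates = SetoidMembershipₚ.∈-deduplicate⁺ ≋-setoid SameSet?
    (λ N≋M L≋N → SameSet-trans L≋N (SameSet-sym N≋M)) M∈subsets

HasAtLeastStable-stableModels : ∀ P → HasAtLeastStable P (length (stableModels P))
HasAtLeastStable-stableModels P =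
  stableModels P , refl , All.all-filter (stable? P) (candidates P) ,
  SetoidUniqueₚ.filter⁺ ≋-setoid (stable? P)
    (DecSetoidUniqueₚ.deduplicate-! ≋-decSetoid (subsets (map head P)))

HasAtMostStable-stableModels : ∀ P → HasAtMostStable P (length (stableModels P))
HasAtMostStable-stableModels P Ms stable distinct =
  Unique⇒length≤ ≋-setoid distinct (All.map (stableModels-complete {P}) stable)

HasAtMostStable-mono : ∀ {P k l} → k ≤ l → HasAtMostStable P k → HasAtMostStable P l
HasAtMostStable-mono k≤l atMost Ms stable distinct = ℕ.≤-trans (atMost Ms stable distinct) k≤l

-- Canonical programs

Reflects : (Atom → Atom) → AtomSet → Set
Reflects f M = ∀ {a} → f a ∈ map f M → a ∈ M

SameSet-map-reflected : ∀ {f M N} → Reflects f M → Reflects f N → SameSet (map f M) (map f N) → SameSet M N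
SameSet-map-reflected {f} reflectsM reflectsN fM≋fN a =
  (λ a∈M → reflectsN (proj₁ (fM≋fN (f a)) (∈-map⁺ f a∈M))) ,
  (λ a∈N → reflectsM (proj₂ (fM≋fN (f a)) (∈-map⁺ f a∈N)))

canonicalClauses : ℕ → List Clause
canonicalClauses m =
  cartesianProductWith (λ h body → h ← proj₁ body ,not proj₂ body) (upTo m) (cartesianProduct bodies bodies)
  where
  bodies = subsets (upTo m)

module Canonical (m : ℕ) (f : Atom → Atom) where

  normalize : List Atom → List Atom
  normalize L = filter (_∈? L) (upTo m)

  canonicalize : Clause → Clause
  canonicalize cl = f (head cl) ← normalize (map f (pos cl)) ,not normalize (map f (neg cl))

  module _ (f<m : ∀ a → f a < m) where

    private
      map⊆upTo : ∀ L → map f L ⊆ upTo m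
      map⊆upTo L d∈ with ∈-map⁻ f d∈
      ... | b , _ , refl = ∈-upTo⁺ (f<m b)

    All-normalize-map⁺ : ∀ {X : Pred Atom 0ℓ} {L} → All (X ∘ f) L → All X (normalize (map f L))
    All-normalize-map⁺ {L = L} =
      All.anti-mono (proj₂ ∘ ∈-filter⁻ (_∈? map f L) {xs = upTo m}) ∘ All.map⁺

    All-normalize-map⁻ : ∀ {X : Pred Atom 0ℓ} {L} → All X (normalize (map f L)) → All (X ∘ f) L
    All-normalize-map⁻ {L = L} = All.map⁻ ∘ All.anti-mono (proj₁ (SameSet-filter-∈ (map⊆upTo L) _))

    canonicalize∈canonicalClauses : ∀ cl → canonicalize cl ∈ canonicalClauses m
    canonicalize∈canonicalClauses cl = ∈-cartesianProductWith⁺ _ (∈-upTo⁺ (f<m (head cl)))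
      (∈-cartesianProduct⁺ (filter∈subsets _ (upTo m)) (filter∈subsets _ (upTo m)))

    module _ {P : Program} {M : AtomSet} (reflects : Reflects f M) where

      private
        Kept-canonicalize⁺ : ∀ {cl} → Kept M cl → Kept (map f M) (canonicalize cl)
        Kept-canonicalize⁺ = All-normalize-map⁺ ∘ All.map (λ c∉M → c∉M ∘ reflects)

        Kept-canonicalize⁻ : ∀ {cl} → Kept (map f M) (canonicalize cl) → Kept M cl
        Kept-canonicalize⁻ = All.map (λ fc∉fM → fc∉fM ∘ ∈-map⁺ f) ∘ All-normalize-map⁻

      stable-canonicalize : IsStableModel P M → IsStableModel (map canonicalize P) (map f M)
      stable-canonicalize (M-model , M-least) = model , least
        where
        model : IsModel (reduct (map canonicalize P) (map f M)) (_∈ map f M)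
        model = IsModel-reduct⁺ {map canonicalize P} λ cl′∈ kept body →
          case ∈-map⁻ canonicalize cl′∈ of λ where
            (cl , cl∈P , refl) → ∈-map⁺ f (IsModel-reduct⁻ {P} M-model cl∈P (Kept-canonicalize⁻ {cl} kept)
                                             (All.map reflects (All-normalize-map⁻ body)))
        least : (X : Pred Atom 0ℓ) → IsModel (reduct (map canonicalize P) (map f M)) X →
                ∀ a → a ∈ map f M → X a
        least X X-model a a∈ with ∈-map⁻ f a∈
        ... | b , b∈M , refl = M-least (X ∘ f) pulled-back b b∈M
          where
          pulled-back : IsModel (reduct P M) (X ∘ f)
          pulled-back = IsModel-reduct⁺ {P} λ {cl} cl∈P kept body →
            IsModel-reduct⁻ {map canonicalize P} X-model (∈-map⁺ canonicalize cl∈P)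
              (Kept-canonicalize⁺ {cl} kept) (All-normalize-map⁺ body)

-- Atoms outside H all go to length H, past the positions of the atoms of H.
position : List Atom → Atom → ℕ
position H a with a ∈? H
... | yes a∈H = toℕ (Any.index a∈H)
... | no _    = length H

position≤length : ∀ H a → position H a ≤ length H
position≤length H a with a ∈? H
... | yes a∈H = ℕ.<⇒≤ (Fin.toℕ<n (Any.index a∈H))
... | no _    = ℕ.≤-refl

position-injective : ∀ {H a b} → b ∈ H → position H a ≡ position H b → a ≡ b
position-injective {H} {a} {b} b∈H eq with a ∈? H | b ∈? H
... | yes a∈H | yes b∈H′ =
  SetoidMembershipₚ.index-injective (≡-setoid Atom) a∈H b∈H′ (Fin.toℕ-injective eq)
... | no _    | yes b∈H′ = contradiction eq (ℕ.>⇒≢ (Fin.toℕ<n (Any.index b∈H′)))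
... | _       | no b∉H   = contradiction b∈H b∉H

position-reflects : ∀ {H M} → M ⊆ H → Reflects (position H) M
position-reflects {H} {M} M⊆H fa∈ with ∈-map⁻ (position H) fa∈
... | b , b∈M , eq = subst (_∈ M) (sym (position-injective (M⊆H b∈M) eq)) b∈M

canonicalForm : ℕ → Program → Program
canonicalForm m P = map (Canonical.canonicalize m (position (map head P))) P

module _ {n} (P : Program) (len : length P ≤ n) where

  private
    f = position (map head P)
    open Canonical (suc n) f using (stable-canonicalize; canonicalize∈canonicalClauses)

    heads≤n : length (map head P) ≤ n
    heads≤n = subst (_≤ n) (sym (List.length-map head P)) len

    f<1+n : ∀ a → f a < suc n
    f<1+n a = s≤s (ℕ.≤-trans (position≤length (map head P) a) heads≤n)

    reflects : ∀ {M} → IsStableModel P M → Reflects f M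
    reflects stable = position-reflects (stable⊆heads {P} stable)

  canonicalForm∈listsUpTo : canonicalForm (suc n) P ∈ listsUpTo n (canonicalClauses (suc n))
  canonicalForm∈listsUpTo = ∈-listsUpTo⁺ (subst (_≤ n) (sym (List.length-map _ P)) len)
    (All.map⁺ (All.tabulate λ {cl} _ → canonicalize∈canonicalClauses f<1+n cl))

  HasAtMostStable-canonicalForm : ∀ {k} → HasAtMostStable (canonicalForm (suc n) P) k → HasAtMostStable P k
  HasAtMostStable-canonicalForm {k} atMost Ms stable distinct =
    subst (_≤ k) (List.length-map (map f) Ms) (atMost (map (map f) Ms)
      (All.map⁺ (All.map (λ st → stable-canonicalize f<1+n {P} (reflects st) st) stable))
      (AllPairs-map⁺-on (λ stM stN M≉N → M≉N ∘ SameSet-map-reflected (reflects stM) (reflects stN))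
        stable distinct))

IsS-exists : ∀ n → Σ ℕ (IsS n)
IsS-exists n = count best , (best , best-length , HasAtLeastStable-stableModels best) , bounded
  where
  count : Program → ℕ
  count = length ∘ stableModels
  programs = listsUpTo n (canonicalClauses (suc n))
  best = argmax count [] programs
  best-length : length best ≤ n
  best-length = argmax-all count z≤n (listsUpTo-length n (canonicalClauses (suc n)))
  bounded : (P : Program) → length P ≤ n → HasAtMostStable P (count best)
  bounded P len = HasAtMostStable-canonicalForm P len (HasAtMostStable-mono {canonicalForm (suc n) P}
    (All.lookup (f[xs]≤f[argmax] {f = count} [] programs) (canonicalForm∈listsUpTo P len))
    (HasAtMostStable-stableModels (canonicalForm (suc n) P)))

-- One more stable model

guard : Atom → Clause → Clause
guard z cl = head cl ← pos cl ,not (z ∷ neg cl)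

extend : Atom → Program → Program
extend z P = (z ← [] ,not map head P) ∷ map (guard z) P

reduct-guard : ∀ {z M} P → z ∉ M → reduct (map (guard z) P) M ≡ reduct P M
reduct-guard {z} {M} P z∉M = begin
  map toPos (filter (kept? M) (map (guard z) P))
    ≡⟨ cong (map toPos) (filter-map (kept? M) (guard z) P) ⟩
  map toPos (map (guard z) (filter (kept? M ∘ guard z) P))
    ≡⟨ List.map-∘ (filter (kept? M ∘ guard z) P) ⟨  -- toPos ∘ guard z reduces to toPos
  map toPos (filter (kept? M ∘ guard z) P)
    ≡⟨ cong (map toPos) (List.filter-≐ (kept? M ∘ guard z) (kept? M) (All.tail , (z∉M ∷_)) P) ⟩
  map toPos (filter (kept? M) P)
    ∎
  where open ≡-Reasoning

module _ {z P} (z∉heads : z ∉ map head P) where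

  stable-extend : ∀ {M a} → a ∈ M → IsStableModel P M → IsStableModel (extend z P) M
  stable-extend {M} a∈M stable = subst (λ Q → IsLeastModel Q M) (sym reduct-extend) stable
    where
    M⊆heads = stable⊆heads {P} stable
    reduct-extend : reduct (extend z P) M ≡ reduct P M
    reduct-extend = begin
      reduct (extend z P) M       ≡⟨ cong (map toPos) (List.filter-reject (kept? M)
                                       (λ kept → All.All¬⇒¬Any kept (lose (M⊆heads a∈M) a∈M))) ⟩
      reduct (map (guard z) P) M  ≡⟨ reduct-guard P (z∉heads ∘ M⊆heads) ⟩
      reduct P M                  ∎
      where open ≡-Reasoning

  stable-extend-singleton : IsStableModel (extend z P) (z ∷ [])
  stable-extend-singleton = subst (λ Q → IsLeastModel Q (z ∷ [])) (sym reduct-extend) (fact-leastModel z)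
    where
    reduct-extend : reduct (extend z P) (z ∷ []) ≡ (z ⇐ []) ∷ []
    reduct-extend = cong (map toPos) (begin
      filter (kept? (z ∷ [])) (extend z P)
        ≡⟨ List.filter-accept (kept? (z ∷ []))
             (All.tabulate λ { h∈heads (here refl) → z∉heads h∈heads }) ⟩
      (z ← [] ,not map head P) ∷ filter (kept? (z ∷ [])) (map (guard z) P)
        ≡⟨ cong ((z ← [] ,not map head P) ∷_) (List.filter-none (kept? (z ∷ [])) {xs = map (guard z) P}
             (All.map⁺ (All.tabulate λ _ kept → All.head kept (here refl)))) ⟩
      (z ← [] ,not map head P) ∷ []
        ∎)
      where open ≡-Reasoning

  HasAtLeastStable-extend : ∀ {Ms} →
    All (IsStableModel P) Ms → All (λ M → ∃[ a ] a ∈ M) Ms → Unique Ms →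
    HasAtLeastStable (extend z P) (suc (length Ms))
  HasAtLeastStable-extend stable nonempty distinct =
    (z ∷ []) ∷ _ , refl ,
    stable-extend-singleton ∷ All.zipWith (λ (st , (_ , a∈M)) → stable-extend a∈M st) (stable , nonempty) ,
    All.map (λ st [z]≋M → z∉heads (stable⊆heads {P} st (proj₁ ([z]≋M z) (here refl)))) stable
      ∷ distinct

fact₀ : Program
fact₀ = (0 ← [] ,not []) ∷ []

-- extend 1 fact₀ is the program {1 ← not 0, 0 ← not 1}.
two-stable : HasAtLeastStable (extend 1 fact₀) 2
two-stable = HasAtLeastStable-extend {1} {fact₀} (λ { (here ()) ; (there ()) })
  (fact-leastModel 0 ∷ []) ((0 , here refl) ∷ []) ([] ∷ [])

IsS-maximal : ∀ {m b} P {k} → IsS m b → length P ≤ m → HasAtLeastStable P k → k ≤ b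
IsS-maximal P (_ , atMost) len (Ms , refl , stable , distinct) = atMost P len Ms stable distinct

IsS-increasing : ∀ {n a b} → 1 ≤ n → IsS n a → IsS (suc n) b → a < b
IsS-increasing 1≤n ((_ , _ , [] , refl , _) , _) s[1+n] =
  ℕ.<-≤-trans (s≤s z≤n) (IsS-maximal (extend 1 fact₀) s[1+n] (s≤s 1≤n) two-stable)
IsS-increasing 1≤n ((_ , _ , _ ∷ [] , refl , _) , _) s[1+n] =
  IsS-maximal (extend 1 fact₀) s[1+n] (s≤s 1≤n) two-stable
IsS-increasing {n} 1≤n ((P , len , _ ∷ _ ∷ _ , refl , stable , distinct) , _) s[1+n] =
  IsS-maximal (extend z P) s[1+n] (s≤s (subst (_≤ n) (sym (List.length-map (guard z) P)) len))
    (HasAtLeastStable-extend (fresh-∉ (map head P)) stable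
      (distinct-stable-nonempty {P} stable distinct) distinct)
  where
  z = fresh (map head P)

lemma10 : (n : ℕ) → 1 ≤ n →
    Σ ℕ λ a → Σ ℕ λ b → IsS n a × IsS (suc n) b × a < b
lemma10 n 1≤n =
  let a , s[n] = IsS-exists n
      b , s[1+n] = IsS-exists (suc n)
  in  a , b , s[n] , s[1+n] , IsS-increasing 1≤n s[n] s[1+n]
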